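{- Let $k \ge 3$. There is no permutation $p \in \mathfrak{S}_k$ for which there exists $n > k$ such that the set $S_n\{p\} = \{w \in \mathfrak{S}_n : w \text{ avoids } p\}$ is an order ideal of $\mathfrak{S}_n$ in the Bruhat order.
   Context: For $p\in\mathfrak{S}_k$, $w\in\mathfrak{S}_n$ contains $p$ if there are indices $i_1<\cdots<i_k$ with $w(i_h)<w(i_j)$ iff $p(h)<p(j)$; otherwise $w$ avoids $p$. The Bruhat order on $\mathfrak{S}_n$ is generated by $w\lessdot w'$ whenever $\ell(w')=\ell(w)+1$ and $w'=tw$ for a transposition $t$, with $\ell$ the number of inversions. A subset $I$ of a poset is an order ideal if $y\in I$ and $x\le y$ imply $x\in I$. -}

module Defs where

open import Data.Nat using (ℕ; suc)
open import Data.Fin using (Fin; _<_; _<?_)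
open import Data.Fin.Permutation using (Permutation′; _⟨$⟩ʳ_; transpose)
open import Data.List using (List; length; filter; cartesianProduct; allFin)
open import Data.Product using (Σ; ∃; _×_; _,_; proj₁; proj₂)
open import Relation.Nullary.Decidable using (_×-dec_)
open import Relation.Nullary using (¬_)
open import Relation.Binary.PropositionalEquality using (_≡_)
open import Function.Bundles using (_⇔_)

Perm : ℕ → Set
Perm n = Permutation′ n

inv : ∀ {n} → Perm n → ℕ
inv {n} w = length (filter (λ ij → (proj₁ ij <? proj₂ ij) ×-dec ((w ⟨$⟩ʳ proj₂ ij) <? (w ⟨$⟩ʳ proj₁ ij)))
                           (cartesianProduct (allFin n) (allFin n)))

Contains : ∀ {n k} → Perm n → Perm k → Set
Contains {n} {k} w p =
  Σ (Fin k → Fin n) λ f →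
    (∀ a b → a < b → f a < f b) ×
    (∀ h j → ((w ⟨$⟩ʳ f h) < (w ⟨$⟩ʳ f j)) ⇔ ((p ⟨$⟩ʳ h) < (p ⟨$⟩ʳ j)))

Avoids : ∀ {n k} → Perm n → Perm k → Set
Avoids w p = ¬ Contains w p

_≈P_ : ∀ {n} → Perm n → Perm n → Set
w ≈P v = ∀ x → w ⟨$⟩ʳ x ≡ v ⟨$⟩ʳ x

_⋖_ : ∀ {n} → Perm n → Perm n → Set
_⋖_ {n} w w' =
  Σ (Fin n) λ a → Σ (Fin n) λ b → ¬ (a ≡ b) ×
    (∀ x → w' ⟨$⟩ʳ x ≡ transpose a b ⟨$⟩ʳ (w ⟨$⟩ʳ x)) ×
    (inv w' ≡ suc (inv w))

data _≤B_ {n : ℕ} : Perm n → Perm n → Set where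
  refl≤ : ∀ {x y} → x ≈P y → x ≤B y
  step≤ : ∀ {x y z} → x ⋖ y → y ≤B z → x ≤B z

IsOrderIdeal : ∀ {n} → (Perm n → Set) → Set
IsOrderIdeal {n} I = ∀ (x y : Perm n) → I y → x ≤B y → I x

module Submission where

-- The reversal w₀ is the Bruhat maximum: bubble sort reaches it from any w by swapping adjacent
-- ascents, each swap a cover. Pad p to x = id_{D+1} ⊕ p in 𝔖_n, which contains p. If the avoiders of
-- p were an ideal, x ≤ w₀ would force w₀ to contain p, so p would be decreasing. At positions D,
-- D + 1, D + 2 the entries of x form a 132 pattern; swapping its outer entries adds exactly one
-- inversion, giving a cover x ⋖ y, and for k ≥ 3 the longest decreasing subsequence of y has length
-- k − 1. So y avoids p while x ≤ y contains it.

open import Defs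
open import Data.Bool using (Bool; true; false)
open import Data.Empty using (⊥; ⊥-elim)
open import Data.Fin using (Fin; zero; suc; toℕ; _<?_; _≟_; inject₁; fromℕ; _↑ʳ_; punchOut)
open import Data.Fin.Patterns using (0F; 1F; 2F)
import Data.Fin.Properties as Fin
open import Data.Fin.Permutation
  using (_⟨$⟩ʳ_; _⟨$⟩ˡ_; transpose; _∘ₚ_; lift₀; reverse; inverseˡ; lift₀-cong; lift₀-comp; lift₀-transpose)
import Data.Fin.Permutation.Components as PC
open import Data.List using (List; length; filter; cartesianProduct; allFin; tabulate; map; _++_)
import Data.List.Properties as List
open import Data.Nat using (ℕ; zero; suc; _+_; _∸_; _≤_; _<_; z≤n; s≤s; s≤s⁻¹)
import Data.Nat.Properties as ℕ
open import Algebra.Properties.CommutativeMonoid.Sum ℕ.+-0-commutativeMonoid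
  using (sum; sum-syntax; sum-cong-≗; sum-permute)
open import Data.Product using (∃; _×_; _,_; proj₁; proj₂)
open import Function using (_∘_; id; _⇔_; mk⇔; Equivalence; case_of_)
import Function.Properties.Equivalence as ⇔
open import Relation.Binary.PropositionalEquality
open import Relation.Nullary using (¬_; Dec; yes; no; does; contradiction)
open import Relation.Nullary.Decidable using (_×-dec_; does-⇔; dec-true; dec-false; toSum)
open import Data.Sum using (inj₁; inj₂)
open import Relation.Unary using (Decidable)

𝟙 : Bool → ℕ
𝟙 true  = 1
𝟙 false = 0

𝟙-⇔ : {A B : Set} → A ⇔ B → (a? : Dec A) (b? : Dec B) → 𝟙 (does a?) ≡ 𝟙 (does b?)
𝟙-⇔ A⇔B a? b? = cong 𝟙 (does-⇔ A⇔B a? b?)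

module _ {A B : Set} {P : A × B → Set} (P? : Decidable P) where

  length-filter-map-pair : ∀ {n} x (g : Fin n → B) →
    length (filter P? (map (x ,_) (tabulate g))) ≡ ∑[ i < n ] 𝟙 (does (P? (x , g i)))
  length-filter-map-pair {zero}  x g = refl
  length-filter-map-pair {suc n} x g with does (P? (x , g zero))
  ... | true  = cong suc (length-filter-map-pair x (g ∘ suc))
  ... | false = length-filter-map-pair x (g ∘ suc)

  length-filter-cartesianProduct : ∀ {n} (g : Fin n → A) (ys : List B) →
    length (filter P? (cartesianProduct (tabulate g) ys)) ≡
    ∑[ i < n ] length (filter P? (map (g i ,_) ys))
  length-filter-cartesianProduct {zero}  g ys = refl
  length-filter-cartesianProduct {suc n} g ys = begin
    length (filter P? (map (g zero ,_) ys ++ cartesianProduct (tabulate (g ∘ suc)) ys))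
      ≡⟨ cong length (List.filter-++ P? (map (g zero ,_) ys) _) ⟩
    length (filter P? (map (g zero ,_) ys) ++ filter P? (cartesianProduct (tabulate (g ∘ suc)) ys))
      ≡⟨ List.length-++ (filter P? (map (g zero ,_) ys)) ⟩
    length (filter P? (map (g zero ,_) ys)) + length (filter P? (cartesianProduct (tabulate (g ∘ suc)) ys))
      ≡⟨ cong (length (filter P? (map (g zero ,_) ys)) +_) (length-filter-cartesianProduct (g ∘ suc) ys) ⟩
    ∑[ i < suc n ] length (filter P? (map (g i ,_) ys)) ∎
    where open ≡-Reasoning

inverted? : ∀ {n} (f : Fin n → Fin n) (a b : Fin n) → Dec (toℕ a < toℕ b × toℕ (f b) < toℕ (f a))
inverted? f a b = a <? b ×-dec f b <? f a

invSum : ∀ {n} → (Fin n → Fin n) → ℕ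
invSum {n} f = ∑[ a < n ] ∑[ b < n ] 𝟙 (does (inverted? f a b))

inv≡invSum : ∀ {n} (w : Perm n) → inv w ≡ invSum (w ⟨$⟩ʳ_)
inv≡invSum {n} w =
  trans (length-filter-cartesianProduct inversion? id (allFin n))
        (sum-cong-≗ λ a → length-filter-map-pair inversion? a id)
  where
  inversion? : Decidable (λ ((i , j) : Fin n × Fin n) → toℕ i < toℕ j × toℕ (w ⟨$⟩ʳ j) < toℕ (w ⟨$⟩ʳ i))
  inversion? (i , j) = inverted? (w ⟨$⟩ʳ_) i j

sum-suc-at : ∀ {n} (g h : Fin n → ℕ) c → (∀ x → x ≢ c → g x ≡ h x) → g c ≡ suc (h c) →
             sum g ≡ suc (sum h)
sum-suc-at g h zero    g≡h gc = cong₂ _+_ gc (sum-cong-≗ λ x → g≡h (suc x) λ ())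
sum-suc-at g h (suc c) g≡h gc = begin
  g zero + sum (g ∘ suc)      ≡⟨ cong₂ _+_ (g≡h zero λ ()) (sum-suc-at (g ∘ suc) (h ∘ suc) c g∘suc≡h∘suc gc) ⟩
  h zero + suc (sum (h ∘ suc)) ≡⟨ ℕ.+-suc (h zero) _ ⟩
  suc (sum h)                  ∎
  where
  open ≡-Reasoning
  g∘suc≡h∘suc : ∀ x → x ≢ c → g (suc x) ≡ h (suc x)
  g∘suc≡h∘suc x x≢c = g≡h (suc x) (x≢c ∘ Fin.suc-injective)

∑∑-suc-at : ∀ {n} (g h : Fin n → Fin n → ℕ) c d → (∀ x y → ¬ (x ≡ c × y ≡ d) → g x y ≡ h x y) →
            g c d ≡ suc (h c d) → ∑[ x < n ] ∑[ y < n ] g x y ≡ suc (∑[ x < n ] ∑[ y < n ] h x y)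
∑∑-suc-at g h c d g≡h gcd =
  sum-suc-at _ _ c (λ x x≢c → sum-cong-≗ λ y → g≡h x y (x≢c ∘ proj₁))
                   (sum-suc-at _ _ d (λ y y≢d → g≡h c y (y≢d ∘ proj₂)) gcd)

∑∑-permute : ∀ {n} (g : Fin n → Fin n → ℕ) (π : Perm n) →
  ∑[ x < n ] ∑[ y < n ] g x y ≡ ∑[ x < n ] ∑[ y < n ] g (π ⟨$⟩ʳ x) (π ⟨$⟩ʳ y)
∑∑-permute g π = trans (sum-permute _ π) (sum-cong-≗ λ x → sum-permute (g (π ⟨$⟩ʳ x)) π)

sum-mono-≤ : ∀ {n} (g h : Fin n → ℕ) → (∀ x → g x ≤ h x) → sum g ≤ sum h
sum-mono-≤ {zero}  g h g≤h = z≤n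
sum-mono-≤ {suc n} g h g≤h = ℕ.+-mono-≤ (g≤h zero) (sum-mono-≤ (g ∘ suc) (h ∘ suc) (g≤h ∘ suc))

<-respects-≡ : ∀ {n} {x x′ y y′ : Fin n} → x ≡ x′ → y ≡ y′ → toℕ x < toℕ y → toℕ x′ < toℕ y′
<-respects-≡ refl refl = id

invSum-cong : ∀ {n} {f g : Fin n → Fin n} → (∀ x → f x ≡ g x) → invSum f ≡ invSum g
invSum-cong {f = f} {g} f≗g = sum-cong-≗ λ a → sum-cong-≗ λ b →
  𝟙-⇔ (mk⇔ (λ (a<b , fb<fa) → a<b , <-respects-≡ (f≗g b) (f≗g a) fb<fa)
           (λ (a<b , gb<ga) → a<b , <-respects-≡ (sym (f≗g b)) (sym (f≗g a)) gb<ga))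
      (inverted? f a b) (inverted? g a b)

module _ {n} (i j : Fin n) where

  transpose-matchˡ : PC.transpose i j i ≡ j
  transpose-matchˡ with i ≟ i
  ... | yes _  = refl
  ... | no i≢i = contradiction refl i≢i

  transpose-matchʳ : PC.transpose i j j ≡ i
  transpose-matchʳ with j ≟ i
  ... | yes refl = refl
  ... | no _ with j ≟ j
  ...   | yes _  = refl
  ...   | no j≢j = contradiction refl j≢j

  transpose-fixes : ∀ {k} → k ≢ i → k ≢ j → PC.transpose i j k ≡ k
  transpose-fixes {k} k≢i k≢j with k ≟ i
  ... | yes k≡i = contradiction k≡i k≢i
  ... | no _ with k ≟ j
  ...   | yes k≡j = contradiction k≡j k≢j
  ...   | no _    = refl

  transpose-involutive : ∀ k → PC.transpose i j (PC.transpose i j k) ≡ k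
  transpose-involutive k with k ≟ i
  ... | yes refl = transpose-matchʳ
  ... | no k≢i with k ≟ j
  ...   | yes refl = transpose-matchˡ
  ...   | no k≢j   = transpose-fixes k≢i k≢j

⟨$⟩ʳ-injective : ∀ {n} (w : Perm n) {x y : Fin n} → w ⟨$⟩ʳ x ≡ w ⟨$⟩ʳ y → x ≡ y
⟨$⟩ʳ-injective w {x} {y} wx≡wy = trans (sym (inverseˡ w)) (trans (cong (w ⟨$⟩ˡ_) wx≡wy) (inverseˡ w))

transpose-conj : ∀ {n} (w : Perm n) (a b x : Fin n) →
  w ⟨$⟩ʳ PC.transpose a b x ≡ PC.transpose (w ⟨$⟩ʳ a) (w ⟨$⟩ʳ b) (w ⟨$⟩ʳ x)
transpose-conj w a b x with toSum (x ≟ a)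
... | inj₁ refl = trans (cong (w ⟨$⟩ʳ_) (transpose-matchˡ x b)) (sym (transpose-matchˡ (w ⟨$⟩ʳ x) (w ⟨$⟩ʳ b)))
... | inj₂ x≢a with toSum (x ≟ b)
...   | inj₁ refl = trans (cong (w ⟨$⟩ʳ_) (transpose-matchʳ a x)) (sym (transpose-matchʳ (w ⟨$⟩ʳ a) (w ⟨$⟩ʳ x)))
...   | inj₂ x≢b  = trans (cong (w ⟨$⟩ʳ_) (transpose-fixes a b x≢a x≢b))
                         (sym (transpose-fixes _ _ (x≢a ∘ ⟨$⟩ʳ-injective w) (x≢b ∘ ⟨$⟩ʳ-injective w)))

module _ {n} {a b : Fin n} (b≡1+a : toℕ b ≡ suc (toℕ a)) where

  private
    τ : Fin n → Fin n
    τ = PC.transpose a b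

    a<b : toℕ a < toℕ b
    a<b = ℕ.≤-reflexive (sym b≡1+a)

    b≢y⇒a<y⇔b<y : ∀ {y} → y ≢ b → toℕ a < toℕ y ⇔ toℕ b < toℕ y
    b≢y⇒a<y⇔b<y {y} y≢b = mk⇔
      (λ a<y → ℕ.≤∧≢⇒< (subst (_≤ toℕ y) (sym b≡1+a) a<y) (y≢b ∘ Fin.toℕ-injective ∘ sym))
      (λ b<y → ℕ.<-trans a<b b<y)

    a≢x⇒x<a⇔x<b : ∀ {x} → x ≢ a → toℕ x < toℕ a ⇔ toℕ x < toℕ b
    a≢x⇒x<a⇔x<b {x} x≢a = mk⇔
      (λ x<a → ℕ.<-trans x<a a<b)
      (λ x<b → ℕ.≤∧≢⇒< (s≤s⁻¹ (subst (suc (toℕ x) ≤_) b≡1+a x<b)) (x≢a ∘ Fin.toℕ-injective))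

  transpose-adjacent-<-⇔ : ∀ {x y} → ¬ (x ≡ a × y ≡ b) → ¬ (x ≡ b × y ≡ a) →
                           toℕ (τ x) < toℕ (τ y) ⇔ toℕ x < toℕ y
  transpose-adjacent-<-⇔ {x} {y} ¬ab ¬ba with toSum (x ≟ y)
  ... | inj₁ refl = mk⇔ (⊥-elim ∘ ℕ.<-irrefl refl) (⊥-elim ∘ ℕ.<-irrefl refl)
  ... | inj₂ x≢y with toSum (x ≟ a) | toSum (x ≟ b) | toSum (y ≟ a) | toSum (y ≟ b)
  ... | inj₁ refl | _ | _ | inj₁ refl = contradiction (refl , refl) ¬ab
  ... | _ | inj₁ refl | inj₁ refl | _ = contradiction (refl , refl) ¬ba
  ... | inj₁ refl | _ | inj₁ refl | _ = contradiction refl x≢y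
  ... | _ | inj₁ refl | _ | inj₁ refl = contradiction refl x≢y
  ... | inj₁ refl | _ | inj₂ y≢a | inj₂ y≢b
    rewrite transpose-matchˡ x b | transpose-fixes x b y≢a y≢b = ⇔.sym (b≢y⇒a<y⇔b<y y≢b)
  ... | inj₂ _ | inj₁ refl | inj₂ y≢a | inj₂ y≢b
    rewrite transpose-matchʳ a x | transpose-fixes a x y≢a y≢b = b≢y⇒a<y⇔b<y y≢b
  ... | inj₂ x≢a | inj₂ x≢b | inj₁ refl | _
    rewrite transpose-matchˡ y b | transpose-fixes y b x≢a x≢b = ⇔.sym (a≢x⇒x<a⇔x<b x≢a)
  ... | inj₂ x≢a | inj₂ x≢b | inj₂ _ | inj₁ refl
    rewrite transpose-matchʳ a y | transpose-fixes a y x≢a x≢b = a≢x⇒x<a⇔x<b x≢a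
  ... | inj₂ x≢a | inj₂ x≢b | inj₂ y≢a | inj₂ y≢b
    rewrite transpose-fixes a b x≢a x≢b | transpose-fixes a b y≢a y≢b = mk⇔ id id

  -- After reindexing the double sum by τ, only the pair (b , a) changes its indicator.
  invSum-transpose-ascent : (f : Fin n → Fin n) → toℕ (f a) < toℕ (f b) →
                            invSum (f ∘ τ) ≡ suc (invSum f)
  invSum-transpose-ascent f fa<fb = trans (∑∑-permute G (transpose a b)) (∑∑-suc-at G′ H b a G′≡H G′ba)
    where
    G H G′ : Fin n → Fin n → ℕ
    G x y  = 𝟙 (does (inverted? (f ∘ τ) x y))
    H x y  = 𝟙 (does (inverted? f x y))
    G′ x y = G (τ x) (τ y)

    unswap : ∀ x → f (τ (τ x)) ≡ f x
    unswap x = cong f (transpose-involutive a b x)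

    G′≡H-elsewhere : ∀ {x y} → ¬ (x ≡ a × y ≡ b) → ¬ (x ≡ b × y ≡ a) → G′ x y ≡ H x y
    G′≡H-elsewhere {x} {y} ¬ab ¬ba = 𝟙-⇔ (mk⇔
      (λ (τx<τy , fy<fx) → Equivalence.to (transpose-adjacent-<-⇔ ¬ab ¬ba) τx<τy ,
                            <-respects-≡ (unswap y) (unswap x) fy<fx)
      (λ (x<y , fy<fx) → Equivalence.from (transpose-adjacent-<-⇔ ¬ab ¬ba) x<y ,
                          <-respects-≡ (sym (unswap y)) (sym (unswap x)) fy<fx))
      (inverted? (f ∘ τ) (τ x) (τ y)) (inverted? f x y)

    G′≡H : ∀ x y → ¬ (x ≡ b × y ≡ a) → G′ x y ≡ H x y
    G′≡H x y ¬ba with toSum (x ≟ a) | toSum (y ≟ b)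
    ... | inj₁ refl | inj₁ refl =
      trans (cong 𝟙 (dec-false (inverted? (f ∘ τ) (τ x) (τ y)) λ (τa<τb , _) →
                      ℕ.<-asym a<b (<-respects-≡ (transpose-matchˡ x y) (transpose-matchʳ x y) τa<τb)))
            (sym (cong 𝟙 (dec-false (inverted? f x y) (ℕ.<-asym fa<fb ∘ proj₂))))
    ... | inj₁ refl | inj₂ y≢b = G′≡H-elsewhere (y≢b ∘ proj₂) ¬ba
    ... | inj₂ x≢a | _         = G′≡H-elsewhere (x≢a ∘ proj₁) ¬ba

    G′ba : G′ b a ≡ suc (H b a)
    G′ba = trans (cong 𝟙 (dec-true (inverted? (f ∘ τ) (τ b) (τ a))
                   (<-respects-≡ (sym (transpose-matchʳ a b)) (sym (transpose-matchˡ a b)) a<b ,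
                    <-respects-≡ (sym (unswap a)) (sym (unswap b)) fa<fb)))
                 (cong suc (sym (cong 𝟙 (dec-false (inverted? f b a) (ℕ.<-asym a<b ∘ proj₁)))))

-- _∘ₚ_ composes in diagrammatic order, so transpose a b ∘ₚ w swaps the entries at positions a and b.
⋖-transpose : ∀ {n} (w : Perm n) {a b : Fin n} → a ≢ b →
  invSum ((w ⟨$⟩ʳ_) ∘ PC.transpose a b) ≡ suc (invSum (w ⟨$⟩ʳ_)) → w ⋖ (transpose a b ∘ₚ w)
⋖-transpose w {a} {b} a≢b one-more =
  w ⟨$⟩ʳ a , w ⟨$⟩ʳ b , a≢b ∘ ⟨$⟩ʳ-injective w , transpose-conj w a b ,
  trans (inv≡invSum (transpose a b ∘ₚ w)) (trans one-more (cong suc (sym (inv≡invSum w))))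

⋖-transpose-ascent : ∀ {n} (w : Perm n) {a b : Fin n} → toℕ b ≡ suc (toℕ a) →
  toℕ (w ⟨$⟩ʳ a) < toℕ (w ⟨$⟩ʳ b) → w ⋖ (transpose a b ∘ₚ w)
⋖-transpose-ascent w b≡1+a ascent =
  ⋖-transpose w (λ { refl → ℕ.1+n≢n (sym b≡1+a) }) (invSum-transpose-ascent b≡1+a (w ⟨$⟩ʳ_) ascent)

-- (a c) = (b c)(a b)(b c), and along this factorisation the inversion count changes by −1, +1, +1.
invSum-transpose-132 : ∀ {n} (f : Fin n → Fin n) {a b c : Fin n} →
  toℕ b ≡ suc (toℕ a) → toℕ c ≡ suc (toℕ b) → toℕ (f a) < toℕ (f c) → toℕ (f c) < toℕ (f b) →
  invSum (f ∘ PC.transpose a c) ≡ suc (invSum f)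
invSum-transpose-132 {n} f {a} {b} {c} b≡1+a c≡1+b fa<fc fc<fb = begin
  invSum (f ∘ PC.transpose a c)  ≡⟨ invSum-cong (cong f ∘ σ₁₂σ₀₁σ₁₂≗σ₀₂) ⟨
  invSum (g₂ ∘ σ₁₂)              ≡⟨ invSum-transpose-ascent c≡1+b g₂ g₂b<g₂c ⟩
  suc (invSum (g₁ ∘ σ₀₁))        ≡⟨ cong suc (invSum-transpose-ascent b≡1+a g₁ g₁a<g₁b) ⟩
  suc (suc (invSum g₁))          ≡⟨ cong suc (invSum-transpose-ascent c≡1+b g₁ g₁b<g₁c) ⟨
  suc (invSum (g₁ ∘ σ₁₂))        ≡⟨ cong suc (invSum-cong (cong f ∘ transpose-involutive b c)) ⟩
  suc (invSum f)                 ∎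
  where
  open ≡-Reasoning
  σ₀₁ σ₁₂ g₁ g₂ : Fin n → Fin n
  σ₀₁ = PC.transpose a b
  σ₁₂ = PC.transpose b c
  g₁ = f ∘ σ₁₂
  g₂ = g₁ ∘ σ₀₁

  a≢b : a ≢ b
  a≢b refl = ℕ.1+n≢n (sym b≡1+a)
  b≢c : b ≢ c
  b≢c refl = ℕ.1+n≢n (sym c≡1+b)
  a≢c : a ≢ c
  a≢c refl = ℕ.<-asym (ℕ.≤-reflexive (sym b≡1+a)) (ℕ.≤-reflexive (sym c≡1+b))

  σ₁₂a : σ₁₂ a ≡ a
  σ₁₂a = transpose-fixes b c a≢b a≢c
  σ₁₂b : σ₁₂ b ≡ c
  σ₁₂b = transpose-matchˡ b c

  g₁a : g₁ a ≡ f a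
  g₁a = cong f σ₁₂a
  g₁b : g₁ b ≡ f c
  g₁b = cong f σ₁₂b
  g₁c : g₁ c ≡ f b
  g₁c = cong f (transpose-matchʳ b c)
  g₂b : g₂ b ≡ f a
  g₂b = trans (cong g₁ (transpose-matchʳ a b)) g₁a
  g₂c : g₂ c ≡ f b
  g₂c = trans (cong g₁ (transpose-fixes a b (a≢c ∘ sym) (b≢c ∘ sym))) g₁c

  g₁a<g₁b : toℕ (g₁ a) < toℕ (g₁ b)
  g₁a<g₁b = <-respects-≡ (sym g₁a) (sym g₁b) fa<fc
  g₁b<g₁c : toℕ (g₁ b) < toℕ (g₁ c)
  g₁b<g₁c = <-respects-≡ (sym g₁b) (sym g₁c) fc<fb
  g₂b<g₂c : toℕ (g₂ b) < toℕ (g₂ c)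
  g₂b<g₂c = <-respects-≡ (sym g₂b) (sym g₂c) (ℕ.<-trans fa<fc fc<fb)

  σ₁₂σ₀₁σ₁₂≗σ₀₂ : ∀ z → σ₁₂ (σ₀₁ (σ₁₂ z)) ≡ PC.transpose a c z
  σ₁₂σ₀₁σ₁₂≗σ₀₂ z = begin
    σ₁₂ (σ₀₁ (σ₁₂ z))                           ≡⟨ transpose-conj (transpose b c) a b (σ₁₂ z) ⟩
    PC.transpose (σ₁₂ a) (σ₁₂ b) (σ₁₂ (σ₁₂ z))   ≡⟨ cong₂ (λ u v → PC.transpose u v (σ₁₂ (σ₁₂ z))) σ₁₂a σ₁₂b ⟩
    PC.transpose a c (σ₁₂ (σ₁₂ z))               ≡⟨ cong (PC.transpose a c) (transpose-involutive b c z) ⟩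
    PC.transpose a c z                           ∎

Descending : ∀ {m} → (Fin (suc m) → ℕ) → Set
Descending {m} g = ∀ (i : Fin m) → g (suc i) < g (inject₁ i)

Ascending : ∀ {m} → (Fin (suc m) → ℕ) → Set
Ascending {m} g = ∀ (i : Fin m) → g (inject₁ i) < g (suc i)

descending⇒+toℕ≤head : ∀ {m} (g : Fin (suc m) → ℕ) → Descending g → ∀ x → g x + toℕ x ≤ g zero
descending⇒+toℕ≤head g d zero = ℕ.≤-reflexive (ℕ.+-identityʳ _)
descending⇒+toℕ≤head {suc m} g d (suc x) = begin
  g (suc x) + suc (toℕ x)  ≡⟨ ℕ.+-suc (g (suc x)) (toℕ x) ⟩
  suc (g (suc x) + toℕ x)  ≤⟨ s≤s (descending⇒+toℕ≤head (g ∘ suc) (d ∘ suc) x) ⟩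
  suc (g (suc zero))       ≤⟨ d zero ⟩
  g zero                   ∎
  where open ℕ.≤-Reasoning

descending⇒≤+toℕ : ∀ {m} (g : Fin (suc m) → ℕ) → Descending g → ∀ x → m ≤ g x + toℕ x
descending⇒≤+toℕ {zero}  g d x       = z≤n
descending⇒≤+toℕ {suc m} g d zero    = begin
  suc m                    ≤⟨ s≤s (descending⇒≤+toℕ (g ∘ suc) (d ∘ suc) zero) ⟩
  suc (g (suc zero) + 0)   ≡⟨ cong suc (ℕ.+-identityʳ _) ⟩
  suc (g (suc zero))       ≤⟨ d zero ⟩
  g zero                   ≡⟨ ℕ.+-identityʳ _ ⟨
  g zero + 0               ∎
  where open ℕ.≤-Reasoning
descending⇒≤+toℕ {suc m} g d (suc x) = begin
  suc m                    ≤⟨ s≤s (descending⇒≤+toℕ (g ∘ suc) (d ∘ suc) x) ⟩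
  suc (g (suc x) + toℕ x)  ≡⟨ ℕ.+-suc (g (suc x)) (toℕ x) ⟨
  g (suc x) + suc (toℕ x)  ∎
  where open ℕ.≤-Reasoning

ascending⇒head+toℕ≤ : ∀ {m} (g : Fin (suc m) → ℕ) → Ascending g → ∀ x → g zero + toℕ x ≤ g x
ascending⇒head+toℕ≤ g a zero = ℕ.≤-reflexive (ℕ.+-identityʳ _)
ascending⇒head+toℕ≤ {suc m} g a (suc x) = begin
  g zero + suc (toℕ x)     ≡⟨ ℕ.+-suc (g zero) (toℕ x) ⟩
  suc (g zero + toℕ x)     ≤⟨ ℕ.+-monoˡ-≤ (toℕ x) (a zero) ⟩
  g (suc zero) + toℕ x     ≤⟨ ascending⇒head+toℕ≤ (g ∘ suc) (a ∘ suc) x ⟩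
  g (suc x)                ∎
  where open ℕ.≤-Reasoning

increasing⇒ascending : ∀ {m n} (f : Fin (suc m) → Fin n) → (∀ a b → toℕ a < toℕ b → toℕ (f a) < toℕ (f b)) →
                       Ascending (toℕ ∘ f)
increasing⇒ascending f f↑ i = f↑ (inject₁ i) (suc i) (Fin.≤̄⇒inject₁< ℕ.≤-refl)

descending⇒≈reverse : ∀ {m} (w : Perm (suc m)) → Descending (toℕ ∘ (w ⟨$⟩ʳ_)) → w ≈P reverse
descending⇒≈reverse {m} w d x = Fin.toℕ-injective (begin
  toℕ (w ⟨$⟩ʳ x)                  ≡⟨ ℕ.m+n∸n≡m _ (toℕ x) ⟨
  toℕ (w ⟨$⟩ʳ x) + toℕ x ∸ toℕ x  ≡⟨ cong (_∸ toℕ x) (ℕ.≤-antisym upper (descending⇒≤+toℕ W d x)) ⟩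
  m ∸ toℕ x                       ≡⟨ Fin.opposite-prop x ⟨
  toℕ (reverse ⟨$⟩ʳ x)             ∎)
  where
  open ≡-Reasoning
  W : Fin (suc m) → ℕ
  W = toℕ ∘ (w ⟨$⟩ʳ_)
  upper : toℕ (w ⟨$⟩ʳ x) + toℕ x ≤ m
  upper = ℕ.≤-trans (descending⇒+toℕ≤head W d x) (s≤s⁻¹ (Fin.toℕ<n (w ⟨$⟩ʳ zero)))

pairCount : ℕ → ℕ
pairCount n = ∑[ a < n ] ∑[ b < n ] 1

invSum≤pairCount : ∀ {n} (f : Fin n → Fin n) → invSum f ≤ pairCount n
invSum≤pairCount f = sum-mono-≤ _ _ λ a → sum-mono-≤ _ _ λ b → 𝟙≤1 (does (inverted? f a b))
  where
  𝟙≤1 : ∀ x → 𝟙 x ≤ 1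
  𝟙≤1 true  = ℕ.≤-refl
  𝟙≤1 false = z≤n

AscentAt : ∀ {m} → Perm (suc m) → Fin m → Set
AscentAt w i = toℕ (w ⟨$⟩ʳ inject₁ i) < toℕ (w ⟨$⟩ʳ suc i)

ascent? : ∀ {m} (w : Perm (suc m)) → Dec (∃ (AscentAt w))
ascent? w = Fin.any? λ i → w ⟨$⟩ʳ inject₁ i <? w ⟨$⟩ʳ suc i

no-ascent⇒descending : ∀ {m} (w : Perm (suc m)) → ¬ ∃ (AscentAt w) → Descending (toℕ ∘ (w ⟨$⟩ʳ_))
no-ascent⇒descending w ¬ascent i =
  ℕ.≤∧≢⇒< (ℕ.≮⇒≥ (¬ascent ∘ (i ,_))) (inject₁≢suc ∘ sym ∘ ⟨$⟩ʳ-injective w ∘ Fin.toℕ-injective)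
  where
  inject₁≢suc : inject₁ i ≢ suc i
  inject₁≢suc eq = ℕ.1+n≢n (sym (trans (sym (Fin.toℕ-inject₁ i)) (cong toℕ eq)))

swapAdjacent : ∀ {m} → Perm (suc m) → Fin m → Perm (suc m)
swapAdjacent w i = transpose (inject₁ i) (suc i) ∘ₚ w

⋖-swapAdjacent : ∀ {m} (w : Perm (suc m)) (i : Fin m) → AscentAt w i → w ⋖ swapAdjacent w i
⋖-swapAdjacent w i = ⋖-transpose-ascent w (cong suc (sym (Fin.toℕ-inject₁ i)))

inv-swapAdjacent : ∀ {m} (w : Perm (suc m)) (i : Fin m) → AscentAt w i → inv (swapAdjacent w i) ≡ suc (inv w)
inv-swapAdjacent w i ascent with ⋖-swapAdjacent w i ascent
... | _ , _ , _ , _ , inv≡ = inv≡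

ascent⇒inv<pairCount : ∀ {m} (w : Perm (suc m)) (i : Fin m) → AscentAt w i → inv w < pairCount (suc m)
ascent⇒inv<pairCount {m} w i ascent = begin-strict
  inv w                            <⟨ ℕ.n<1+n (inv w) ⟩
  suc (inv w)                      ≡⟨ inv-swapAdjacent w i ascent ⟨
  inv (swapAdjacent w i)           ≡⟨ inv≡invSum (swapAdjacent w i) ⟩
  invSum (swapAdjacent w i ⟨$⟩ʳ_)  ≤⟨ invSum≤pairCount (swapAdjacent w i ⟨$⟩ʳ_) ⟩
  pairCount (suc m)                ∎
  where open ℕ.≤-Reasoning

-- Bubble sort; the fuel bounds the number of remaining ascent swaps, as inv never exceeds pairCount.
≤B-reverse-within : ∀ {m} fuel (w : Perm (suc m)) → pairCount (suc m) ≤ fuel + inv w → w ≤B reverse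
≤B-reverse-within fuel w bound with ascent? w
... | no ¬ascent = refl≤ (descending⇒≈reverse w (no-ascent⇒descending w ¬ascent))
≤B-reverse-within zero w bound | yes (i , ascent) =
  contradiction bound (ℕ.<⇒≱ (ascent⇒inv<pairCount w i ascent))
≤B-reverse-within {m} (suc fuel) w bound | yes (i , ascent) =
  step≤ (⋖-swapAdjacent w i ascent) (≤B-reverse-within fuel (swapAdjacent w i) (begin
    pairCount (suc m)              ≤⟨ bound ⟩
    suc fuel + inv w               ≡⟨ ℕ.+-suc fuel (inv w) ⟨
    fuel + suc (inv w)             ≡⟨ cong (fuel +_) (inv-swapAdjacent w i ascent) ⟨
    fuel + inv (swapAdjacent w i)  ∎))
  where open ℕ.≤-Reasoning

≤B-reverse : ∀ {n} (w : Perm n) → w ≤B reverse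
≤B-reverse {zero}  w = refl≤ λ ()
≤B-reverse {suc m} w = ≤B-reverse-within _ w (ℕ.m≤m+n _ (inv w))

contains-refl : ∀ {k} (p : Perm k) → Contains p p
contains-refl p = id , (λ _ _ → id) , (λ _ _ → mk⇔ id id)

lift₀-contains : ∀ {k n} {p : Perm k} {q : Perm n} → Contains q p → Contains (lift₀ q) p
lift₀-contains (f , f↑ , f≈) =
  suc ∘ f , (λ a b → s≤s ∘ f↑ a b) ,
  λ h j → mk⇔ (Equivalence.to (f≈ h j) ∘ s≤s⁻¹) (s≤s ∘ Equivalence.from (f≈ h j))

-- An occurrence cannot use the new least entry at position 0, since p does not start with its minimum.
lift₀-avoids : ∀ {k n} {p : Perm (suc k)} {q : Perm n} (j : Fin k) →
  toℕ (p ⟨$⟩ʳ suc j) < toℕ (p ⟨$⟩ʳ zero) → Avoids q p → Avoids (lift₀ q) p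
lift₀-avoids {k} {n} {p} {q} j pj<p0 q-avoids (f , f↑ , f≈) with f zero in f0≡
... | zero  = ℕ.n≮0 (subst (λ z → toℕ (lift₀ q ⟨$⟩ʳ f (suc j)) < toℕ (lift₀ q ⟨$⟩ʳ z)) f0≡
                          (Equivalence.from (f≈ (suc j) zero) pj<p0))
... | suc _ = q-avoids (f′ , f′↑ , f′≈)
  where
  zero≢f : ∀ a → zero ≢ f a
  zero≢f zero    eq = case trans eq f0≡ of λ ()
  zero≢f (suc a) eq = ℕ.n≮0 (subst (λ z → toℕ (f zero) < toℕ z) (sym eq) (f↑ zero (suc a) (s≤s z≤n)))

  f′ : Fin (suc k) → Fin n
  f′ a = punchOut (zero≢f a)

  f≡suc∘f′ : ∀ a → f a ≡ suc (f′ a)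
  f≡suc∘f′ a = sym (Fin.punchIn-punchOut (zero≢f a))

  f′↑ : ∀ a b → toℕ a < toℕ b → toℕ (f′ a) < toℕ (f′ b)
  f′↑ a b = s≤s⁻¹ ∘ <-respects-≡ (f≡suc∘f′ a) (f≡suc∘f′ b) ∘ f↑ a b

  f′≈ : ∀ h j → (toℕ (q ⟨$⟩ʳ f′ h) < toℕ (q ⟨$⟩ʳ f′ j)) ⇔ (toℕ (p ⟨$⟩ʳ h) < toℕ (p ⟨$⟩ʳ j))
  f′≈ h j = mk⇔
    (λ lt → Equivalence.to (f≈ h j) (<-respects-≡ (cong (lift₀ q ⟨$⟩ʳ_) (sym (f≡suc∘f′ h)))
                                                  (cong (lift₀ q ⟨$⟩ʳ_) (sym (f≡suc∘f′ j))) (s≤s lt)))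
    (λ lt → s≤s⁻¹ (<-respects-≡ (cong (lift₀ q ⟨$⟩ʳ_) (f≡suc∘f′ h))
                               (cong (lift₀ q ⟨$⟩ʳ_) (f≡suc∘f′ j)) (Equivalence.from (f≈ h j) lt)))

liftN : ∀ D {m} → Perm m → Perm (D + m)
liftN zero    q = q
liftN (suc D) q = lift₀ (liftN D q)

liftN-contains : ∀ D {k n} {p : Perm k} {q : Perm n} → Contains q p → Contains (liftN D q) p
liftN-contains zero    occurrence = occurrence
liftN-contains (suc D) {p = p} {q} occurrence =
  lift₀-contains {p = p} {liftN D q} (liftN-contains D {p = p} {q} occurrence)

liftN-avoids : ∀ D {k n} {p : Perm (suc k)} {q : Perm n} (j : Fin k) →
  toℕ (p ⟨$⟩ʳ suc j) < toℕ (p ⟨$⟩ʳ zero) → Avoids q p → Avoids (liftN D q) p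
liftN-avoids zero    j pj<p0 q-avoids = q-avoids
liftN-avoids (suc D) {p = p} {q} j pj<p0 q-avoids =
  lift₀-avoids {p = p} {liftN D q} j pj<p0 (liftN-avoids D {p = p} {q} j pj<p0 q-avoids)

liftN-↑ʳ : ∀ D {m} (q : Perm m) (r : Fin m) → liftN D q ⟨$⟩ʳ (D ↑ʳ r) ≡ D ↑ʳ (q ⟨$⟩ʳ r)
liftN-↑ʳ zero    q r = refl
liftN-↑ʳ (suc D) q r = cong suc (liftN-↑ʳ D q r)

liftN-transpose : ∀ D {m} (a b : Fin m) (q : Perm m) →
  liftN D (transpose a b ∘ₚ q) ≈P (transpose (D ↑ʳ a) (D ↑ʳ b) ∘ₚ liftN D q)
liftN-transpose zero    a b q z = refl
liftN-transpose (suc D) a b q z = begin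
  lift₀ (liftN D (transpose a b ∘ₚ q)) ⟨$⟩ʳ z          ≡⟨ lift₀-cong _ _ (liftN-transpose D a b q) z ⟩
  lift₀ (t ∘ₚ liftN D q) ⟨$⟩ʳ z                        ≡⟨ lift₀-comp t (liftN D q) z ⟨
  lift₀ (liftN D q) ⟨$⟩ʳ (lift₀ t ⟨$⟩ʳ z)               ≡⟨ cong (lift₀ (liftN D q) ⟨$⟩ʳ_) (lift₀-transpose _ _ z) ⟨
  lift₀ (liftN D q) ⟨$⟩ʳ (transpose (suc D ↑ʳ a) (suc D ↑ʳ b) ⟨$⟩ʳ z) ∎
  where
  open ≡-Reasoning
  t : Perm _
  t = transpose (D ↑ʳ a) (D ↑ʳ b)

Decreasing : ∀ {k} → Perm k → Set
Decreasing {k} p = ∀ (h j : Fin k) → toℕ h < toℕ j → toℕ (p ⟨$⟩ʳ j) < toℕ (p ⟨$⟩ʳ h)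

reverse-contains⇒decreasing : ∀ {k n} {p : Perm k} → Contains (reverse {n}) p → Decreasing p
reverse-contains⇒decreasing {n = n} (f , f↑ , f≈) h j h<j = Equivalence.to (f≈ j h) (begin-strict
  toℕ (reverse ⟨$⟩ʳ f j)  ≡⟨ Fin.opposite-prop (f j) ⟩
  n ∸ suc (toℕ (f j))     <⟨ ℕ.∸-monoʳ-< (s≤s (f↑ h j h<j)) (Fin.toℕ<n (f j)) ⟩
  n ∸ suc (toℕ (f h))     ≡⟨ Fin.opposite-prop (f h) ⟨
  toℕ (reverse ⟨$⟩ʳ f h)  ∎)
  where open ℕ.≤-Reasoning

swap₀₂ : ∀ {k} → Perm (3 + k) → Perm (4 + k)
swap₀₂ p = transpose 0F 2F ∘ₚ lift₀ p

-- swap₀₂ p reads 1 + p 1, 1 + p 0, 0, 1 + p 2, …; a decreasing occurrence of p would have its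
-- second letter among the first three positions (f1<3), and each choice fails.
swap₀₂-avoids : ∀ {k} (p : Perm (3 + k)) → Decreasing p → Avoids (swap₀₂ p) p
swap₀₂-avoids {k} p p↓ (f , f↑ , f≈) =
  no-decreasing-triple (f 0F) (f 1F) (f 2F)
    (f↑ 0F 1F (s≤s z≤n)) (q↓ 0F 1F (s≤s z≤n)) (q↓ 1F 2F (s≤s (s≤s z≤n))) f1<3
  where
  q : Perm (4 + k)
  q = swap₀₂ p

  q↓ : ∀ h j → toℕ h < toℕ j → toℕ (q ⟨$⟩ʳ f j) < toℕ (q ⟨$⟩ʳ f h)
  q↓ h j h<j = Equivalence.from (f≈ j h) (p↓ h j h<j)

  f∘suc-ascending : Ascending (toℕ ∘ f ∘ suc)
  f∘suc-ascending = increasing⇒ascending (f ∘ suc) (λ a b → f↑ (suc a) (suc b) ∘ s≤s)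

  f1<3 : toℕ (f 1F) < 3
  f1<3 = ℕ.+-cancelʳ-< (suc k) (toℕ (f 1F)) 3 (begin-strict
    toℕ (f 1F) + suc k                ≡⟨ cong (toℕ (f 1F) +_) (Fin.toℕ-fromℕ (suc k)) ⟨
    toℕ (f 1F) + toℕ (fromℕ (suc k))  ≤⟨ ascending⇒head+toℕ≤ (toℕ ∘ f ∘ suc) f∘suc-ascending (fromℕ (suc k)) ⟩
    toℕ (f (suc (fromℕ (suc k))))     <⟨ Fin.toℕ<n _ ⟩
    4 + k                             ∎)
    where open ℕ.≤-Reasoning

  no-decreasing-triple : ∀ u v w → toℕ u < toℕ v →
    toℕ (q ⟨$⟩ʳ v) < toℕ (q ⟨$⟩ʳ u) → toℕ (q ⟨$⟩ʳ w) < toℕ (q ⟨$⟩ʳ v) → toℕ v < 3 → ⊥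
  no-decreasing-triple _       0F _ ()        _     _      _
  no-decreasing-triple 0F      1F _ _         q1<q0 _      _ = ℕ.<-asym (s≤s (p↓ 0F 1F (s≤s z≤n))) q1<q0
  no-decreasing-triple (suc _) 1F _ (s≤s ())  _     _      _
  no-decreasing-triple _       2F _ _         _     qw<q2  _ = ℕ.n≮0 qw<q2
  no-decreasing-triple _ (suc (suc (suc _))) _ _ _  _      (s≤s (s≤s (s≤s ())))

↑ʳ-next : ∀ D {m} {r s : Fin m} → toℕ s ≡ suc (toℕ r) → toℕ (D ↑ʳ s) ≡ suc (toℕ (D ↑ʳ r))
↑ʳ-next zero    s≡1+r = s≡1+r
↑ʳ-next (suc D) s≡1+r = cong suc (↑ʳ-next D s≡1+r)

↑ʳ-mono-< : ∀ D {m} {r s : Fin m} → toℕ r < toℕ s → toℕ (D ↑ʳ r) < toℕ (D ↑ʳ s)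
↑ʳ-mono-< zero    r<s = r<s
↑ʳ-mono-< (suc D) r<s = s≤s (↑ʳ-mono-< D r<s)

liftN-lift₀≤Bswap₀₂ : ∀ {k} D (p : Perm (3 + k)) → toℕ (p ⟨$⟩ʳ 1F) < toℕ (p ⟨$⟩ʳ 0F) →
                      liftN D (lift₀ p) ≤B liftN D (swap₀₂ p)
liftN-lift₀≤Bswap₀₂ D p p1<p0 =
  step≤ {y = transpose (D ↑ʳ 0F) (D ↑ʳ 2F) ∘ₚ x} x⋖ (refl≤ (sym ∘ liftN-transpose D 0F 2F (lift₀ p)))
  where
  x : Perm _
  x = liftN D (lift₀ p)

  x[_]≡ : ∀ r → x ⟨$⟩ʳ (D ↑ʳ r) ≡ D ↑ʳ (lift₀ p ⟨$⟩ʳ r)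
  x[ r ]≡ = liftN-↑ʳ D (lift₀ p) r

  one-more : invSum ((x ⟨$⟩ʳ_) ∘ PC.transpose (D ↑ʳ 0F) (D ↑ʳ 2F)) ≡ suc (invSum (x ⟨$⟩ʳ_))
  one-more = invSum-transpose-132 (x ⟨$⟩ʳ_) (↑ʳ-next D refl) (↑ʳ-next D refl)
    (<-respects-≡ (sym x[ 0F ]≡) (sym x[ 2F ]≡) (↑ʳ-mono-< D (s≤s z≤n)))
    (<-respects-≡ (sym x[ 2F ]≡) (sym x[ 1F ]≡) (↑ʳ-mono-< D (s≤s p1<p0)))

  x⋖ : x ⋖ (transpose (D ↑ʳ 0F) (D ↑ʳ 2F) ∘ₚ x)
  x⋖ = ⋖-transpose x (λ eq → case Fin.↑ʳ-injective D 0F 2F eq of λ ()) one-more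

avoiders-not-ideal : ∀ {k} D (p : Perm (3 + k)) → ¬ IsOrderIdeal {D + (4 + k)} (λ w → Avoids w p)
avoiders-not-ideal D p ideal = ideal x reverse reverse-avoids (≤B-reverse x) x-contains
  where
  x : Perm _
  x = liftN D (lift₀ p)

  x-contains : Contains x p
  x-contains = liftN-contains D {p = p} {lift₀ p} (lift₀-contains {p = p} {p} (contains-refl p))

  reverse-avoids : Avoids reverse p
  reverse-avoids reverse-contains =
    ideal x y y-avoids (liftN-lift₀≤Bswap₀₂ D p p1<p0) x-contains
    where
    p↓ : Decreasing p
    p↓ = reverse-contains⇒decreasing {p = p} reverse-contains
    p1<p0 : toℕ (p ⟨$⟩ʳ 1F) < toℕ (p ⟨$⟩ʳ 0F)
    p1<p0 = p↓ 0F 1F (s≤s z≤n)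
    y : Perm _
    y = liftN D (swap₀₂ p)
    y-avoids : Avoids y p
    y-avoids = liftN-avoids D {p = p} {swap₀₂ p} 0F p1<p0 (swap₀₂-avoids p p↓)

theorem7p1 : (k : ℕ) → 3 ≤ k → (p : Perm k) →
    ¬ (∃ λ (n : ℕ) → (k < n) × IsOrderIdeal {n} (λ w → Avoids w p))
theorem7p1 (suc (suc (suc k))) (s≤s (s≤s (s≤s _))) p (n , k<n , ideal) =
  avoiders-not-ideal D p (subst (λ n → IsOrderIdeal {n} (λ w → Avoids w p)) (sym D+4+k≡n) ideal)
  where
  D : ℕ
  D = proj₁ (ℕ.m≤n⇒∃[o]m+o≡n k<n)
  D+4+k≡n : D + (4 + k) ≡ n
  D+4+k≡n = trans (ℕ.+-comm D (4 + k)) (proj₂ (ℕ.m≤n⇒∃[o]m+o≡n k<n))
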